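{- For every time $t\ge 0$ of Random-deletion, if $d_t$ is the number of indices in $A_t^{OPT}$ that the optimal algorithm deletes, and $c_t$ and $w_t$ are the numbers of correct and wrong moves made by Random-deletion up to and including time $t$, then $|A_t^{OPT}\setminus A_t|\le d_t+w_t-c_t$.
   Context: $T$ is a finite set of open parentheses, each $x\in T$ with unique congruent close parenthesis $\bar{x}$; well-formed means belonging to the Dyck language $S\to SS\mid\varepsilon\mid aS\bar{a}$. Input $\sigma=\sigma[1]\cdots\sigma[n]$ over $T\cup\bar{T}$. Random-deletion: scan left to right with a stack; push open parentheses; on a close parenthesis, delete it if the stack is empty, match (pop) it with the stack top if they match, and otherwise delete either the stack top or the current symbol with probability $1/2$ each independently; after the scan, delete the remaining stack symbols one at a time. Time starts at $t=0$ and increases by one at every match or deletion. Fix an optimal deletion-only solution ("the optimal algorithm"): a stack-based single-scan procedure that pushes opens, pops on a match and on a mismatch deletes the stack top or the current close parenthesis, using exactly the minimum number of deletions needed to make $\sigma$ well-formed; it determines which indices are deleted and which pairs are matched. $A_t$ is the set of indices matched or deleted by Random-deletion up to and including time $t$; $A_t^{OPT}=\{i : i\in A_t \text{ or } i \text{ is matched by the optimal algorithm with some index in } A_t\}$. A deletion at time $t$ is a correct move if $|A_t^{OPT}\setminus A_t|\le|A_{t-1}^{OPT}\setminus A_{t-1}|$ and a wrong move otherwise. -}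

module Defs where

open import Data.Nat using (ℕ; zero; suc; _+_; _∸_; _≤_; _<_; _≤?_)
open import Data.Fin using (Fin; _≟_)
open import Data.Bool using (Bool; true; false; _∧_; _∨_; not; if_then_else_)
open import Data.List using (List; []; _∷_; _++_; map; take; drop; length; upTo)
open import Data.Bool.ListAction using (any)
open import Relation.Binary.PropositionalEquality using (_≡_)
open import Data.Product using (_×_; _,_; proj₁)
open import Relation.Nullary using (yes; no)
open import Relation.Nullary.Decidable using (⌊_⌋)
open import Data.Nat.Properties using () renaming (_≟_ to _≟ℕ_)

data Sym (k : ℕ) : Set where
  op : Fin k → Sym k
  cl : Fin k → Sym k

data Dyck {k : ℕ} : List (Sym k) → Set where
  ε    : Dyck []
  cat  : ∀ {u v} → Dyck u → Dyck v → Dyck (u ++ v)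
  wrap : ∀ {u} (a : Fin k) → Dyck u → Dyck (op a ∷ u ++ cl a ∷ [])

select : {A : Set} → List Bool → List A → List A
select []           _        = []
select (_ ∷ _)      []       = []
select (true ∷ bs)  (a ∷ as) = a ∷ select bs as
select (false ∷ bs) (a ∷ as) = select bs as

countFalse : List Bool → ℕ
countFalse []           = 0
countFalse (true ∷ bs)  = countFalse bs
countFalse (false ∷ bs) = suc (countFalse bs)

-- Events of a stack-based single scan (indices are 0-based positions in σ).

data Event : Set where
  matchE : ℕ → ℕ → Event   -- open at index j matched with close at index i
  delE   : ℕ → Event

Stack : ℕ → Set
Stack k = List (ℕ × Fin k)  -- head = stack top; (index , open symbol)

-- Choices on mismatches: the m-th mismatch uses  coins m ;
-- true = delete the stack top, false = delete the current close symbol.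
Coins : Set
Coins = ℕ → Bool

closeStep : {k : ℕ} → ℕ → Fin k → Stack k → Coins → ℕ →
            List Event × Stack k × ℕ
closeStep i x [] c m = (delE i ∷ [] , [] , m)
closeStep i x ((j , y) ∷ s) c m with x ≟ y
... | yes _ = (matchE j i ∷ [] , s , m)
... | no _  with c m
...   | true  with closeStep i x s c (suc m)
...     | (es , s′ , m′) = (delE j ∷ es , s′ , m′)
closeStep i x ((j , y) ∷ s) c m | no _ | false =
  (delE i ∷ [] , (j , y) ∷ s , suc m)

-- scan i σ stack coins m : events of the scan of the remaining input σ,
-- whose first symbol has index i; at the end the remaining stack symbols
-- are deleted one at a time, from the top down.
scan : {k : ℕ} → ℕ → List (Sym k) → Stack k → Coins → ℕ → List Event
scan i []          s c m = map (λ p → delE (proj₁ p)) s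
scan i (op x ∷ σ)  s c m = scan (suc i) σ ((i , x) ∷ s) c m
scan i (cl x ∷ σ)  s c m with closeStep i x s c m
... | (es , s′ , m′) = es ++ scan (suc i) σ s′ c m′

-- The full sequence of events (one per time step t = 1, 2, ...)
run : {k : ℕ} → List (Sym k) → Coins → List Event
run σ c = scan 0 σ [] c 0

count : (ℕ → Bool) → List ℕ → ℕ
count p []       = 0
count p (x ∷ xs) = if p x then suc (count p xs) else count p xs

isDel : Event → Bool
isDel (matchE _ _) = false
isDel (delE _)     = true

numDel : List Event → ℕ
numDel []       = 0
numDel (e ∷ es) = if isDel e then suc (numDel es) else numDel es

_==_ : ℕ → ℕ → Bool
a == b = ⌊ a ≟ℕ b ⌋

touches : Event → ℕ → Bool
touches (matchE j i) x = (x == j) ∨ (x == i)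
touches (delE i)     x = x == i

inEvs : List Event → ℕ → Bool
inEvs es x = any (λ e → touches e x) es

deletedIn : List Event → ℕ → Bool
deletedIn es x = any (λ { (delE i) → x == i ; (matchE _ _) → false }) es

matchedIn : List Event → ℕ → ℕ → Bool
matchedIn es x y =
  any (λ { (matchE j i) → ((x == j) ∧ (y == i)) ∨ ((x == i) ∧ (y == j))
         ; (delE _) → false }) es

-- Optimality of a choice sequence for the deterministic stack procedure:
-- its number of deletions is at most that of any deletion set that makes σ
-- well-formed (hence equals the minimum).

Optimal : {k : ℕ} → List (Sym k) → Coins → Set
Optimal σ copt =
  ∀ (keep : List Bool) → length keep ≡′ length σ → Dyck (select keep σ) →
  numDel (run σ copt) ≤ countFalse keep
  where
  open import Relation.Binary.PropositionalEquality using () renaming (_≡_ to _≡′_)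

-- Quantities of the lemma, for input σ, Random-deletion events R and
-- optimal-algorithm events O.  A_t = indices in the first t events of R.

module Quantities {k : ℕ} (σ : List (Sym k)) (R O : List Event) where

  n : ℕ
  n = length σ

  idx : List ℕ
  idx = upTo n

  A : ℕ → ℕ → Bool
  A t = inEvs (take t R)

  Aopt : ℕ → ℕ → Bool
  Aopt t i = A t i ∨ any (λ j → A t j ∧ matchedIn O i j) idx

  gap : ℕ → ℕ
  gap t = count (λ i → Aopt t i ∧ not (A t i)) idx

  d : ℕ → ℕ
  d t = count (λ i → Aopt t i ∧ deletedIn O i) idx

  -- the event at time s (s ≥ 1) is a deletion
  delAt : ℕ → Bool
  delAt s = any isDel (take 1 (drop (s ∸ 1) R))

  correctAt : ℕ → Bool
  correctAt zero    = false
  correctAt (suc s) = delAt (suc s) ∧ ⌊ gap (suc s) ≤? gap s ⌋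

  wrongAt : ℕ → Bool
  wrongAt zero    = false
  wrongAt (suc s) = delAt (suc s) ∧ not ⌊ gap (suc s) ≤? gap s ⌋

  c : ℕ → ℕ
  c t = count correctAt (upTo (suc t))

  w : ℕ → ℕ
  w t = count wrongAt (upTo (suc t))

-- Track the potential
-- |A_t^OPT ∖ A_t| − d_t. Processing one index x either lowers it by one (when the optimal
-- algorithm deletes x or the partner of x is already processed), or lets the unprocessed partner
-- of x enter A_t^OPT, which raises the potential by at most one and makes the gap grow. So a
-- deletion that does not increase the gap lowers the potential, and any deletion raises it by at
-- most one. A match (j, i) of Random-deletion processes two indices and cannot raise the
-- potential: every index strictly between j and i is already processed, so if both j and i
-- had unprocessed partners, the two matches of the optimal algorithm would cross. Hence the
-- potential is at most w_t − c_t, which is the claim.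

module Submission where

open import Defs
open import Data.Bool using (Bool; true; false; _∧_; _∨_; not)
open import Data.Bool.ListAction using (any)
open import Data.Bool.Properties
  using (∨-assoc; ∨-identityʳ; ∨-zeroʳ; ∧-zeroʳ; ∧-identityʳ; ∧-inverseʳ)
open import Data.Empty using (⊥; ⊥-elim)
open import Data.Fin using (Fin) renaming (_≟_ to _≟ᶠ_)
open import Data.List using (List; []; _∷_; _++_; [_]; map; take; drop; length; upTo; _∷ʳ_)
open import Data.List.Properties using (upTo-∷ʳ)
open import Data.List.Membership.Propositional using (_∈_)
open import Data.List.Membership.Propositional.Properties using (∈-upTo⁺; ∈-upTo⁻)
open import Data.List.Relation.Unary.Any using (here; there)
open import Data.Nat using (ℕ; zero; suc; _+_; _≤_; _<_; _≤?_; z≤n; z<s)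
open import Data.Nat.ListAction using (sum)
open import Data.Nat.Properties
open import Data.List.Membership.DecPropositional _≟_ using (_∈?_)
open import Data.Nat.Tactic.RingSolver using (solve)
open import Algebra.Properties.CommutativeSemigroup +-commutativeSemigroup
  using () renaming (interchange to +-interchange)
open import Data.Product using (_×_; _,_; proj₁; proj₂; ∃-syntax)
open import Data.Sum using (_⊎_; inj₁; inj₂)
import Data.Sum as Sum
open import Function using (_∘_)
open import Relation.Binary.PropositionalEquality
  using (_≡_; _≢_; refl; sym; trans; cong; cong₂; subst; subst₂; _≗_; module ≡-Reasoning)
open import Relation.Nullary using (yes; no; ¬_)
open import Relation.Nullary.Decidable using (⌊_⌋)

private
  variable
    A : Set
    p : A → Bool
    x y : ℕ
    xs : List A

==-refl : ∀ x → (x == x) ≡ true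
==-refl x with x ≟ x
... | yes _ = refl
... | no x≢x = ⊥-elim (x≢x refl)

==⇒≡ : (x == y) ≡ true → x ≡ y
==⇒≡ {x} {y} _ with x ≟ y
... | yes x≡y = x≡y

≢⇒==-false : x ≢ y → (x == y) ≡ false
≢⇒==-false {x} {y} x≢y with x ≟ y
... | yes x≡y = ⊥-elim (x≢y x≡y)
... | no _ = refl

∨-true-l : ∀ {b} c → b ≡ true → (b ∨ c) ≡ true
∨-true-l c refl = refl

∨-true-r : ∀ b {c} → c ≡ true → (b ∨ c) ≡ true
∨-true-r b refl = ∨-zeroʳ b

∨-false : ∀ {b c} → b ≡ false → c ≡ false → (b ∨ c) ≡ false
∨-false refl refl = refl

∨-false-l : ∀ {b c} → (b ∨ c) ≡ false → b ≡ false
∨-false-l {false} _ = refl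

true≢false : true ≢ false
true≢false ()

∨-true-split : ∀ b {c} → (b ∨ c) ≡ true → b ≡ true ⊎ c ≡ true
∨-true-split true  _ = inj₁ refl
∨-true-split false h = inj₂ h

∧-true-split : ∀ b {c} → (b ∧ c) ≡ true → b ≡ true × c ≡ true
∧-true-split true h = refl , h

any-++ : (p : A → Bool) (xs ys : List A) → any p (xs ++ ys) ≡ any p xs ∨ any p ys
any-++ p []       ys = refl
any-++ p (x ∷ xs) ys = trans (cong (p x ∨_) (any-++ p xs ys)) (sym (∨-assoc (p x) _ _))

any-false : (∀ x → p x ≡ false) → (xs : List A) → any p xs ≡ false
any-false p≡false []       = refl
any-false p≡false (x ∷ xs) rewrite p≡false x = any-false p≡false xs

toℕ : Bool → ℕ
toℕ false = 0
toℕ true  = 1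

count-++ : (p : ℕ → Bool) (xs ys : List ℕ) → count p (xs ++ ys) ≡ count p xs + count p ys
count-++ p []       ys = refl
count-++ p (x ∷ xs) ys with p x
... | true  = cong suc (count-++ p xs ys)
... | false = count-++ p xs ys

count-false : (p : ℕ → Bool) → (∀ x → p x ≡ false) → (xs : List ℕ) → count p xs ≡ 0
count-false p p≡false []       = refl
count-false p p≡false (x ∷ xs) rewrite p≡false x = count-false p p≡false xs

count-singleton : (p : ℕ → Bool) (x : ℕ) → count p [ x ] ≡ toℕ (p x)
count-singleton p x with p x
... | true  = refl
... | false = refl

count-upTo-suc : (p : ℕ → Bool) (n : ℕ) → count p (upTo (suc n)) ≡ count p (upTo n) + toℕ (p n)
count-upTo-suc p n = begin
  count p (upTo (suc n))         ≡⟨ cong (count p) (sym (upTo-∷ʳ n)) ⟩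
  count p (upTo n ∷ʳ n)          ≡⟨ count-++ p (upTo n) [ n ] ⟩
  count p (upTo n) + count p [ n ] ≡⟨ cong (count p (upTo n) +_) (count-singleton p n) ⟩
  count p (upTo n) + toℕ (p n)   ∎
  where open ≡-Reasoning

count-upTo-== : ∀ {n} → x < n → count (_== x) (upTo n) ≡ 1
count-upTo-== {x} {suc n} x<1+n rewrite count-upTo-suc (_== x) n with n ≟ x
... | yes refl = cong (_+ 1) (count-upTo-none n (λ i<n → ≢⇒==-false (<⇒≢ i<n)))
  where
  count-upTo-none : ∀ m → (∀ {i} → i < m → (i == n) ≡ false) → count (_== n) (upTo m) ≡ 0
  count-upTo-none zero    _ = refl
  count-upTo-none (suc m) h rewrite count-upTo-suc (_== n) m | h (n<1+n m) =
    trans (+-identityʳ _) (count-upTo-none m (h ∘ m<n⇒m<1+n))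
... | no n≢x = trans (+-identityʳ _) (count-upTo-== (≤∧≢⇒< (≤-pred x<1+n) (n≢x ∘ sym)))

∑ : (ℕ → ℕ) → List ℕ → ℕ
∑ f xs = sum (map f xs)

count≡∑ : (p : ℕ → Bool) (xs : List ℕ) → count p xs ≡ ∑ (toℕ ∘ p) xs
count≡∑ p []       = refl
count≡∑ p (x ∷ xs) with p x
... | true  = cong suc (count≡∑ p xs)
... | false = count≡∑ p xs

∑-+ : (f g : ℕ → ℕ) (xs : List ℕ) → ∑ (λ i → f i + g i) xs ≡ ∑ f xs + ∑ g xs
∑-+ f g []       = refl
∑-+ f g (x ∷ xs) rewrite ∑-+ f g xs = +-interchange (f x) (g x) (∑ f xs) (∑ g xs)

∑-mono-≤ : {f g : ℕ → ℕ} (xs : List ℕ) → (∀ {i} → i ∈ xs → f i ≤ g i) → ∑ f xs ≤ ∑ g xs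
∑-mono-≤ []       f≤g = z≤n
∑-mono-≤ (x ∷ xs) f≤g = +-mono-≤ (f≤g (here refl)) (∑-mono-≤ xs (f≤g ∘ there))

∑-0 : (xs : List ℕ) → ∑ (λ _ → 0) xs ≡ 0
∑-0 []       = refl
∑-0 (x ∷ xs) = ∑-0 xs

-- Drift g d g′ d′ u v: the potential g − d changes to g′ − d′ ≤ (g − d) + v − u,
-- stated with both sides moved so that no subtraction occurs.
record Drift (g d g′ d′ u v : ℕ) : Set where
  constructor drift
  field bound : g′ + d + u ≤ g + d′ + v
open Drift public

module _ {g d g′ d′ u v : ℕ} where

  drift-weaken : ∀ {u′ v′} → u′ + v ≤ u + v′ → Drift g d g′ d′ u v → Drift g d g′ d′ u′ v′
  drift-weaken {u′} {v′} uv (drift h) =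
    drift (+-cancelˡ-≤ (u + v) _ _ (subst₂ _≤_ lhs rhs (+-mono-≤ h uv)))
    where
    lhs : g′ + d + u + (u′ + v) ≡ u + v + (g′ + d + u′)
    lhs = solve (g′ ∷ d ∷ u ∷ u′ ∷ v ∷ [])
    rhs : g + d′ + v + (u + v′) ≡ u + v + (g + d′ + v′)
    rhs = solve (g ∷ d′ ∷ v ∷ u ∷ v′ ∷ [])

  drift-trans : ∀ {g″ d″ u′ v′} → Drift g d g′ d′ u v → Drift g′ d′ g″ d″ u′ v′ →
                Drift g d g″ d″ (u + u′) (v + v′)
  drift-trans {g″} {d″} {u′} {v′} (drift h) (drift h′) =
    drift (+-cancelˡ-≤ (g′ + d′) _ _ (subst₂ _≤_ lhs rhs (+-mono-≤ h h′)))
    where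
    lhs : g′ + d + u + (g″ + d′ + u′) ≡ g′ + d′ + (g″ + d + (u + u′))
    lhs = solve (g′ ∷ d ∷ u ∷ g″ ∷ d′ ∷ u′ ∷ [])
    rhs : g + d′ + v + (g′ + d″ + v′) ≡ g′ + d′ + (g + d″ + (v + v′))
    rhs = solve (g ∷ d′ ∷ v ∷ g′ ∷ d″ ∷ v′ ∷ [])

  drift-+ : ∀ {G D G′ D′ U V} → Drift g d g′ d′ u v → Drift G D G′ D′ U V →
            Drift (g + G) (d + D) (g′ + G′) (d′ + D′) (u + U) (v + V)
  drift-+ {G} {D} {G′} {D′} {U} {V} (drift h) (drift H) = drift (subst₂ _≤_ lhs rhs (+-mono-≤ h H))
    where
    lhs : g′ + d + u + (G′ + D + U) ≡ g′ + G′ + (d + D) + (u + U)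
    lhs = solve (g′ ∷ d ∷ u ∷ G′ ∷ D ∷ U ∷ [])
    rhs : g + d′ + v + (G + D′ + V) ≡ g + G + (d′ + D′) + (v + V)
    rhs = solve (g ∷ d′ ∷ v ∷ G ∷ D′ ∷ V ∷ [])

drift-∑ : {g d g′ d′ u v : ℕ → ℕ} (xs : List ℕ) →
          (∀ {i} → i ∈ xs → Drift (g i) (d i) (g′ i) (d′ i) (u i) (v i)) →
          Drift (∑ g xs) (∑ d xs) (∑ g′ xs) (∑ d′ xs) (∑ u xs) (∑ v xs)
drift-∑ []       h = drift z≤n
drift-∑ (x ∷ xs) h = drift-+ (h (here refl)) (drift-∑ xs (h ∘ there))

∑-indicator : ∀ {n} → x < n → ∑ (λ i → toℕ (i == x)) (upTo n) ≡ 1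
∑-indicator {x} {n} x<n = trans (sym (count≡∑ (_== x) (upTo n))) (count-upTo-== x<n)

any-true : {A : Set} {p : A → Bool} {x : A} {xs : List A} → x ∈ xs → p x ≡ true → any p xs ≡ true
any-true {p = p} (here refl) px rewrite px = refl
any-true {p = p} {xs = y ∷ _} (there x∈xs) px rewrite any-true {p = p} x∈xs px = ∨-zeroʳ (p y)

record Pairing (n : ℕ) (M : ℕ → ℕ → Bool) (Del : ℕ → Bool) : Set where
  field
    partner-unique     : ∀ {x p q} → M x p ≡ true → M x q ≡ true → p ≡ q
    partner-sym        : ∀ {x p} → M x p ≡ true → M p x ≡ true
    partner-≢          : ∀ {x p} → M x p ≡ true → x ≢ p
    partner-<          : ∀ {x p} → M x p ≡ true → p < n
    deleted-unmatched  : ∀ {x p} → Del x ≡ true → M x p ≡ true → ⊥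
    deleted-or-matched : ∀ {x} → x < n → Del x ≡ true ⊎ ∃[ p ] M x p ≡ true

module Potential {n : ℕ} {M : ℕ → ℕ → Bool} {Del : ℕ → Bool} (P : Pairing n M Del) where
  open Pairing P

  idx : List ℕ
  idx = upTo n

  closure : (ℕ → Bool) → ℕ → Bool
  closure a i = a i ∨ any (λ j → a j ∧ M i j) idx

  -- For the processed set a = A_t: closure a = A_t^OPT, gap a = |A_t^OPT ∖ A_t| and dels a = d_t.
  gap dels : (ℕ → Bool) → ℕ
  gap  a = count (λ i → closure a i ∧ not (a i)) idx
  dels a = count (λ i → closure a i ∧ Del i) idx

  gap-at del-at : (ℕ → Bool) → ℕ → ℕ
  gap-at a i = toℕ (closure a i ∧ not (a i))
  del-at a i = toℕ (closure a i ∧ Del i)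

  module _ (a : ℕ → Bool) {i : ℕ} where

    closure-deleted : Del i ≡ true → closure a i ≡ a i
    closure-deleted del-i = trans (cong (a i ∨_) (any-false unmatched idx)) (∨-identityʳ (a i))
      where
      unmatched : ∀ j → (a j ∧ M i j) ≡ false
      unmatched j with M i j in eq
      ... | true  = ⊥-elim (deleted-unmatched del-i eq)
      ... | false = ∧-zeroʳ (a j)

    closure-matched : ∀ {p} → M i p ≡ true → closure a i ≡ a i ∨ a p
    closure-matched {p} mp = cong (a i ∨_) witness
      where
      witness : any (λ j → a j ∧ M i j) idx ≡ a p
      witness with a p in ap
      ... | true  = any-true (∈-upTo⁺ (partner-< mp)) (trans (cong (_∧ M i p) ap) mp)
      ... | false = any-false others idx
        where
        others : ∀ j → (a j ∧ M i j) ≡ false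
        others j with M i j in mj
        ... | true rewrite partner-unique mj mp = trans (∧-identityʳ (a p)) ap
        ... | false = ∧-zeroʳ (a j)

    gap-at-deleted : Del i ≡ true → gap-at a i ≡ 0
    gap-at-deleted del-i rewrite closure-deleted del-i = cong toℕ (∧-inverseʳ (a i))

    del-at-deleted : Del i ≡ true → del-at a i ≡ toℕ (a i)
    del-at-deleted del-i rewrite closure-deleted del-i | del-i = cong toℕ (∧-identityʳ (a i))

    gap-at-matched : ∀ {p} → M i p ≡ true → gap-at a i ≡ toℕ (not (a i) ∧ a p)
    gap-at-matched {p} mp rewrite closure-matched mp with a i
    ... | true  = refl
    ... | false = cong toℕ (∧-identityʳ (a p))

    del-at-matched : ∀ {p} → M i p ≡ true → del-at a i ≡ 0
    del-at-matched mp with Del i in del-i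
    ... | true  = ⊥-elim (deleted-unmatched del-i mp)
    ... | false = cong toℕ (∧-zeroʳ (closure a i))

  gap-∅ : gap (λ _ → false) ≡ 0
  gap-∅ = count-false _ (λ i → trans (∧-identityʳ _) (any-false (λ _ → refl) idx)) idx

  gap-≡-∑ : ∀ a → gap a ≡ ∑ (gap-at a) idx
  gap-≡-∑ a = count≡∑ _ idx

  dels-≡-∑ : ∀ a → dels a ≡ ∑ (del-at a) idx
  dels-≡-∑ a = count≡∑ _ idx

  drift-of-pointwise : ∀ {a a′ u v} →
    (∀ {i} → i < n → Drift (gap-at a i) (del-at a i) (gap-at a′ i) (del-at a′ i) (u i) (v i)) →
    Drift (gap a) (dels a) (gap a′) (dels a′) (∑ u idx) (∑ v idx)
  drift-of-pointwise {a} {a′} h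
    rewrite gap-≡-∑ a | gap-≡-∑ a′ | dels-≡-∑ a | dels-≡-∑ a′ = drift-∑ idx (h ∘ ∈-upTo⁻)

  table-deleted : ∀ b c → (c ≡ true → b ≡ false) → Drift 0 (toℕ b) 0 (toℕ (b ∨ c)) (toℕ c) 0
  table-deleted true  true  c⇒¬b with () ← c⇒¬b refl
  table-deleted true  false _ = drift ≤-refl
  table-deleted false true  _ = drift ≤-refl
  table-deleted false false _ = drift ≤-refl

  table-settled-matched : ∀ ai ap cx px →
    (cx ≡ true → ai ≡ false × ap ≡ true × px ≡ false) → (px ≡ true → ai ≡ true) →
    Drift (toℕ (not ai ∧ ap)) 0 (toℕ (not (ai ∨ cx) ∧ (ap ∨ px))) 0 (toℕ cx) 0
  table-settled-matched ai    ap    true  px    h _ with h refl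
  ... | refl , refl , refl = drift ≤-refl
  table-settled-matched true  ap    false px    _ _ = drift z≤n
  table-settled-matched false ap    false true  _ h with () ← h refl
  table-settled-matched false true  false false _ _ = drift ≤-refl
  table-settled-matched false false false false _ _ = drift ≤-refl

  table-pending-matched : ∀ ai ap cx px cy →
    (cx ≡ true → ai ≡ false × ap ≡ false × px ≡ false × cy ≡ false) →
    (cy ≡ true → ai ≡ false × ap ≡ false × cx ≡ false × px ≡ true) →
    (px ≡ true → cy ≡ true) →
    Drift (toℕ (not ai ∧ ap)) 0 (toℕ (not (ai ∨ cx) ∧ (ap ∨ px))) 0 0 (toℕ cy)
    × toℕ (not ai ∧ ap) + toℕ cy ≤ toℕ (not (ai ∨ cx) ∧ (ap ∨ px))
  table-pending-matched ai    ap    true  px    cy    h _ _ with h refl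
  ... | refl , refl , refl , refl = drift z≤n , z≤n
  table-pending-matched ai    ap    false px    true  _ h _ with h refl
  ... | refl , refl , refl , refl = drift ≤-refl , ≤-refl
  table-pending-matched ai    ap    false true  false _ _ h with () ← h refl
  table-pending-matched true  ap    false false false _ _ _ = drift z≤n , z≤n
  table-pending-matched false true  false false false _ _ _ = drift ≤-refl , ≤-refl
  table-pending-matched false false false false false _ _ _ = drift ≤-refl , ≤-refl

  Settled : (ℕ → Bool) → ℕ → Set
  Settled a x = Del x ≡ true ⊎ ∃[ y ] (M x y ≡ true × a y ≡ true)

  -- Processing x is settled when x is deleted by the pairing or its partner is already processed;
  -- otherwise its partner y enters the closure.
  data Touch (a a′ : ℕ → Bool) (x : ℕ) : Set where
    settled : Drift (gap a) (dels a) (gap a′) (dels a′) 1 0 → Touch a a′ x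
    pending : ∀ {y} → M x y ≡ true → a y ≡ false →
              Drift (gap a) (dels a) (gap a′) (dels a′) 0 1 → gap a < gap a′ → Touch a a′ x

  module _ {a a′ : ℕ → Bool} {x : ℕ} (a′≗ : ∀ i → a′ i ≡ a i ∨ (i == x)) (x∉a : a x ≡ false) where

    drift-at-settled : Settled a x → ∀ {i} → i < n →
      Drift (gap-at a i) (del-at a i) (gap-at a′ i) (del-at a′ i) (toℕ (i == x)) 0
    drift-at-settled settled-x {i} i<n with deleted-or-matched i<n
    ... | inj₁ del-i
      rewrite gap-at-deleted a del-i | gap-at-deleted a′ del-i
            | del-at-deleted a del-i | del-at-deleted a′ del-i | a′≗ i
      = table-deleted (a i) (i == x) (λ i=x → trans (cong a (==⇒≡ i=x)) x∉a)
    ... | inj₂ (p , mp)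
      rewrite gap-at-matched a mp | gap-at-matched a′ mp
            | del-at-matched a mp | del-at-matched a′ mp | a′≗ i | a′≗ p
      = table-settled-matched (a i) (a p) (i == x) (p == x)
          (λ i=x → i-is-x (==⇒≡ i=x) settled-x) (λ p=x → p-is-x (==⇒≡ p=x) settled-x)
      where
      i-is-x : i ≡ x → Settled a x →
               a i ≡ false × a p ≡ true × (p == x) ≡ false
      i-is-x refl (inj₁ del-x) = ⊥-elim (deleted-unmatched del-x mp)
      i-is-x refl (inj₂ (y , my , ay)) rewrite partner-unique mp my =
        x∉a , ay , ≢⇒==-false (partner-≢ my ∘ sym)
      p-is-x : p ≡ x → Settled a x → a i ≡ true
      p-is-x refl (inj₁ del-x) = ⊥-elim (deleted-unmatched del-x (partner-sym mp))
      p-is-x refl (inj₂ (y , my , ay)) rewrite partner-unique (partner-sym mp) my = ay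

    module _ {y : ℕ} (my : M x y ≡ true) (y∉a : a y ≡ false) where

      drift-at-pending : ∀ {i} → i < n →
        Drift (gap-at a i) (del-at a i) (gap-at a′ i) (del-at a′ i) 0 (toℕ (i == y))
        × gap-at a i + toℕ (i == y) ≤ gap-at a′ i
      drift-at-pending {i} i<n with deleted-or-matched i<n
      ... | inj₁ del-i
        rewrite gap-at-deleted a del-i | gap-at-deleted a′ del-i
              | del-at-deleted a del-i | del-at-deleted a′ del-i | a′≗ i
              | ≢⇒==-false {i} {x} (λ { refl → deleted-unmatched del-i my })
              | ≢⇒==-false {i} {y} (λ { refl → deleted-unmatched del-i (partner-sym my) })
        = table-deleted (a i) false (λ ()) , z≤n
      ... | inj₂ (p , mp)
        rewrite gap-at-matched a mp | gap-at-matched a′ mp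
              | del-at-matched a mp | del-at-matched a′ mp | a′≗ i | a′≗ p
        = table-pending-matched (a i) (a p) (i == x) (p == x) (i == y)
            (i-is-x ∘ ==⇒≡) (i-is-y ∘ ==⇒≡) (p-is-x ∘ ==⇒≡)
        where
        i-is-x : i ≡ x → a i ≡ false × a p ≡ false × (p == x) ≡ false × (i == y) ≡ false
        i-is-x refl rewrite partner-unique mp my =
          x∉a , y∉a , ≢⇒==-false (partner-≢ my ∘ sym) , ≢⇒==-false (partner-≢ my)
        i-is-y : i ≡ y → a i ≡ false × a p ≡ false × (i == x) ≡ false × (p == x) ≡ true
        i-is-y refl rewrite partner-unique mp (partner-sym my) =
          y∉a , x∉a , ≢⇒==-false (partner-≢ my ∘ sym) , ==-refl x
        p-is-x : p ≡ x → (i == y) ≡ true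
        p-is-x refl rewrite partner-unique (partner-sym mp) my = ==-refl _

    drift-settled : x < n → Settled a x →
                    Drift (gap a) (dels a) (gap a′) (dels a′) 1 0
    drift-settled x<n settled-x = subst₂ (Drift _ _ _ _) (∑-indicator x<n) (∑-0 idx)
      (drift-of-pointwise (drift-at-settled settled-x))

    touch : x < n → Touch a a′ x
    touch x<n with deleted-or-matched x<n
    ... | inj₁ del-x = settled (drift-settled x<n (inj₁ del-x))
    ... | inj₂ (y , my) with a y in ay
    ...   | true  = settled (drift-settled x<n (inj₂ (y , my , ay)))
    ...   | false = pending my ay drift-pending gap-grows
      where
      unit : ∑ (λ i → toℕ (i == y)) idx ≡ 1
      unit = ∑-indicator (partner-< my)
      drift-pending : Drift (gap a) (dels a) (gap a′) (dels a′) 0 1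
      drift-pending = subst₂ (Drift (gap a) (dels a) (gap a′) (dels a′)) (∑-0 idx) unit
        (drift-of-pointwise (proj₁ ∘ drift-at-pending my ay))
      gap-grows : gap a < gap a′
      gap-grows = begin-strict
        gap a                                      <⟨ n<1+n (gap a) ⟩
        suc (gap a)                                ≡⟨ +-comm 1 (gap a) ⟩
        gap a + 1                                  ≡⟨ cong₂ _+_ (gap-≡-∑ a) (sym unit) ⟩
        ∑ (gap-at a) idx + ∑ (λ i → toℕ (i == y)) idx ≡⟨ sym (∑-+ (gap-at a) _ idx) ⟩
        ∑ (λ i → gap-at a i + toℕ (i == y)) idx
          ≤⟨ ∑-mono-≤ idx (proj₂ ∘ drift-at-pending my ay ∘ ∈-upTo⁻) ⟩
        ∑ (gap-at a′) idx                          ≡⟨ sym (gap-≡-∑ a′) ⟩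
        gap a′                                     ∎
        where open ≤-Reasoning

-- The suc clause comes first so that isOpenAt (c ∷ τ) (suc x) reduces for a variable c.
isOpenAt : {k : ℕ} → List (Sym k) → ℕ → Bool
isOpenAt []         _       = false
isOpenAt (_ ∷ σ)    (suc x) = isOpenAt σ x
isOpenAt (op _ ∷ _) zero    = true
isOpenAt (cl _ ∷ _) zero    = false

_⊕_ : (ℕ → Bool) → Event → ℕ → Bool
(D ⊕ e) x = D x ∨ touches e x

_⊕⋆_ : (ℕ → Bool) → List Event → ℕ → Bool
(D ⊕⋆ es) x = D x ∨ inEvs es x

module Legality {k : ℕ} (σ : List (Sym k)) where

  n : ℕ
  n = length σ

  data LegalEvent (D : ℕ → Bool) : Event → Set where
    legal-del   : ∀ {x} → x < n → D x ≡ false → LegalEvent D (delE x)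
    legal-match : ∀ {j i} → j < i → i < n → D j ≡ false → D i ≡ false →
                  isOpenAt σ j ≡ true → isOpenAt σ i ≡ false →
                  (∀ {x} → j < x → x < i → D x ≡ true) → LegalEvent D (matchE j i)

  data Legal (D : ℕ → Bool) : List Event → Set where
    []  : Legal D []
    _∷_ : ∀ {e es} → LegalEvent D e → Legal (D ⊕ e) es → Legal D (e ∷ es)

  LegalEvent-resp : ∀ {D D′ e} → D ≗ D′ → LegalEvent D e → LegalEvent D′ e
  LegalEvent-resp D≗D′ (legal-del x<n fx) = legal-del x<n (trans (sym (D≗D′ _)) fx)
  LegalEvent-resp D≗D′ (legal-match j<i i<n fj fi oj ci between) =
    legal-match j<i i<n (trans (sym (D≗D′ _)) fj) (trans (sym (D≗D′ _)) fi) oj ci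
      (λ j<x x<i → trans (sym (D≗D′ _)) (between j<x x<i))

  Legal-resp : ∀ {D D′ es} → D ≗ D′ → Legal D es → Legal D′ es
  Legal-resp D≗D′ []         = []
  Legal-resp D≗D′ (_∷_ {e} ok oks) =
    LegalEvent-resp D≗D′ ok ∷ Legal-resp (λ x → cong (_∨ touches e x) (D≗D′ x)) oks

  Legal-++ : ∀ {D es rest} → Legal D es → Legal (D ⊕⋆ es) rest → Legal D (es ++ rest)
  Legal-++ {D} [] oks = Legal-resp (λ x → ∨-identityʳ (D x)) oks
  Legal-++ {D} {e ∷ es} (ok ∷ oks) oks′ =
    ok ∷ Legal-++ oks (Legal-resp (λ x → sym (∨-assoc (D x) (touches e x) (inEvs es x))) oks′)

  _∈ˢ_ : ℕ → Stack k → Set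
  x ∈ˢ s = x ∈ map proj₁ s

  data OpenStack (b : ℕ) : Stack k → Set where
    []   : OpenStack b []
    push : ∀ {j y s} → j < b → isOpenAt σ j ≡ true → OpenStack j s → OpenStack b ((j , y) ∷ s)

  OpenStack-weaken : ∀ {b b′ s} → b ≤ b′ → OpenStack b s → OpenStack b′ s
  OpenStack-weaken b≤b′ []               = []
  OpenStack-weaken b≤b′ (push j<b oj st) = push (<-≤-trans j<b b≤b′) oj st

  OpenStack-below : ∀ {b s x} → OpenStack b s → x ∈ˢ s → x < b
  OpenStack-below (push j<b _ _)  (here refl) = j<b
  OpenStack-below (push j<b _ st) (there x∈s) = <-trans (OpenStack-below st x∈s) j<b

  -- The scan is about to read index i, with stack s, having touched the indices in D.
  record ScanInv (D : ℕ → Bool) (i : ℕ) (s : Stack k) : Set where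
    field
      stack           : OpenStack i s
      stacked-fresh   : ∀ {x} → x ∈ˢ s → D x ≡ false
      scanned-touched : ∀ {x} → x < i → ¬ x ∈ˢ s → D x ≡ true
      unscanned-fresh : ∀ {x} → i ≤ x → D x ≡ false
  open ScanInv

  ScanInv-resp : ∀ {D D′ i s} → D ≗ D′ → ScanInv D i s → ScanInv D′ i s
  ScanInv-resp D≗D′ inv = record
    { stack           = stack inv
    ; stacked-fresh   = λ x∈s → trans (sym (D≗D′ _)) (stacked-fresh inv x∈s)
    ; scanned-touched = λ x<i x∉s → trans (sym (D≗D′ _)) (scanned-touched inv x<i x∉s)
    ; unscanned-fresh = λ i≤x → trans (sym (D≗D′ _)) (unscanned-fresh inv i≤x)
    }

  private
    ∉-pop : ∀ {x j y} {s : Stack k} → x ≢ j → ¬ x ∈ˢ s → ¬ x ∈ˢ ((j , y) ∷ s)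
    ∉-pop x≢j x∉s (here x≡j)  = x≢j x≡j
    ∉-pop x≢j x∉s (there x∈s) = x∉s x∈s

  delete-current : ∀ {D i s} → ScanInv D i s → i < n →
                   LegalEvent D (delE i) × ScanInv (D ⊕ delE i) (suc i) s
  delete-current {D} {i} {s} inv i<n = legal-del i<n (unscanned-fresh inv ≤-refl) , record
    { stack           = OpenStack-weaken (n≤1+n i) (stack inv)
    ; stacked-fresh   = λ x∈s → ∨-false (stacked-fresh inv x∈s)
                                        (≢⇒==-false (<⇒≢ (OpenStack-below (stack inv) x∈s)))
    ; scanned-touched = touched
    ; unscanned-fresh = λ i<x → ∨-false (unscanned-fresh inv (<⇒≤ i<x))
                                        (≢⇒==-false (>⇒≢ i<x))
    }
    where
    touched : ∀ {x} → x < suc i → ¬ x ∈ˢ s → (D x ∨ (x == i)) ≡ true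
    touched {x} x<1+i x∉s with x ≟ i
    ... | yes refl = ∨-zeroʳ (D x)
    ... | no x≢i   = ∨-true-l _ (scanned-touched inv (≤∧≢⇒< (≤-pred x<1+i) x≢i) x∉s)

  match-top : ∀ {D i j y s} → ScanInv D i ((j , y) ∷ s) → isOpenAt σ i ≡ false → i < n →
              LegalEvent D (matchE j i) × ScanInv (D ⊕ matchE j i) (suc i) s
  match-top {D} {i} {j} {y} {s} inv ci i<n with stack inv
  ... | push j<i oj st =
    legal-match j<i i<n (stacked-fresh inv (here refl)) (unscanned-fresh inv ≤-refl) oj ci between
    , record
    { stack           = OpenStack-weaken (≤-trans (<⇒≤ j<i) (n≤1+n i)) st
    ; stacked-fresh   = λ x∈s → let x<j = OpenStack-below st x∈s in
        ∨-false (stacked-fresh inv (there x∈s))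
                (∨-false (≢⇒==-false (<⇒≢ x<j)) (≢⇒==-false (<⇒≢ (<-trans x<j j<i))))
    ; scanned-touched = touched
    ; unscanned-fresh = λ i<x → ∨-false (unscanned-fresh inv (<⇒≤ i<x))
        (∨-false (≢⇒==-false (>⇒≢ (<-trans j<i i<x))) (≢⇒==-false (>⇒≢ i<x)))
    }
    where
    between : ∀ {x} → j < x → x < i → D x ≡ true
    between {x} j<x x<i =
      scanned-touched inv x<i (∉-pop {y = y} (>⇒≢ j<x) (<⇒≱ j<x ∘ <⇒≤ ∘ OpenStack-below st))
    touched : ∀ {x} → x < suc i → ¬ x ∈ˢ s → (D x ∨ ((x == j) ∨ (x == i))) ≡ true
    touched {x} x<1+i x∉s with x ≟ j | x ≟ i
    ... | yes refl | _        = ∨-zeroʳ (D x)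
    ... | no _     | yes refl = ∨-zeroʳ (D x)
    ... | no x≢j   | no x≢i   =
      ∨-true-l _ (scanned-touched inv (≤∧≢⇒< (≤-pred x<1+i) x≢i) (∉-pop {y = y} x≢j x∉s))

  delete-top : ∀ {D i j y s} → ScanInv D i ((j , y) ∷ s) → i < n →
               LegalEvent D (delE j) × ScanInv (D ⊕ delE j) i s
  delete-top {D} {i} {j} {y} {s} inv i<n with stack inv
  ... | push j<i oj st = legal-del (<-trans j<i i<n) (stacked-fresh inv (here refl)) , record
    { stack           = OpenStack-weaken (<⇒≤ j<i) st
    ; stacked-fresh   = λ x∈s → ∨-false (stacked-fresh inv (there x∈s))
                                        (≢⇒==-false (<⇒≢ (OpenStack-below st x∈s)))
    ; scanned-touched = touched
    ; unscanned-fresh = λ i≤x → ∨-false (unscanned-fresh inv i≤x)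
                                        (≢⇒==-false (>⇒≢ (<-≤-trans j<i i≤x)))
    }
    where
    touched : ∀ {x} → x < i → ¬ x ∈ˢ s → (D x ∨ (x == j)) ≡ true
    touched {x} x<i x∉s with x ≟ j
    ... | yes refl = ∨-zeroʳ (D x)
    ... | no x≢j   = ∨-true-l _ (scanned-touched inv x<i (∉-pop {y = y} x≢j x∉s))

  closeStep-legal : ∀ {D i s} (x : Fin k) c m → ScanInv D i s → isOpenAt σ i ≡ false → i < n →
    Legal D (proj₁ (closeStep i x s c m)) ×
    ScanInv (D ⊕⋆ proj₁ (closeStep i x s c m)) (suc i) (proj₁ (proj₂ (closeStep i x s c m)))
  closeStep-legal {D} {i} {[]} x c m inv ci i<n =
    let ok , inv′ = delete-current inv i<n in
    ok ∷ [] , ScanInv-resp (λ z → cong (D z ∨_) (sym (∨-identityʳ _))) inv′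
  closeStep-legal {D} {i} {(j , y) ∷ s} x c m inv ci i<n with x ≟ᶠ y
  ... | yes _ =
    let ok , inv′ = match-top inv ci i<n in
    ok ∷ [] , ScanInv-resp (λ z → cong (D z ∨_) (sym (∨-identityʳ _))) inv′
  ... | no _ with c m
  ...   | false =
    let ok , inv′ = delete-current inv i<n in
    ok ∷ [] , ScanInv-resp (λ z → cong (D z ∨_) (sym (∨-identityʳ _))) inv′
  ...   | true with closeStep i x s c (suc m)
                  | closeStep-legal x c (suc m) (proj₂ (delete-top inv i<n)) ci i<n
  ...     | es , _ , _ | oks , inv′ =
    proj₁ (delete-top inv i<n) ∷ oks ,
    ScanInv-resp (λ z → ∨-assoc (D z) (z == j) (inEvs es z)) inv′

  flush : Stack k → List Event
  flush s = map (λ p → delE (proj₁ p)) s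

  flush-legal : ∀ {D b s} → OpenStack b s → b ≤ n → (∀ {x} → x ∈ˢ s → D x ≡ false) →
                Legal D (flush s)
  flush-legal []                 b≤n fresh = []
  flush-legal (push j<b oj st) b≤n fresh =
    legal-del (<-≤-trans j<b b≤n) (fresh (here refl)) ∷
    flush-legal st (≤-trans (<⇒≤ j<b) b≤n)
      (λ x∈s → ∨-false (fresh (there x∈s)) (≢⇒==-false (<⇒≢ (OpenStack-below st x∈s))))

  flush-covers : ∀ {x} (s : Stack k) → x ∈ˢ s → inEvs (flush s) x ≡ true
  flush-covers {x} (_ ∷ s) (here refl) rewrite ==-refl x = refl
  flush-covers {x} ((j , _) ∷ s) (there x∈s) rewrite flush-covers s x∈s = ∨-zeroʳ (x == j)

  ⊕⋆-++ : ∀ D es rest → (D ⊕⋆ (es ++ rest)) ≗ ((D ⊕⋆ es) ⊕⋆ rest)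
  ⊕⋆-++ D es rest x =
    trans (cong (D x ∨_) (any-++ (λ e → touches e x) es rest)) (sym (∨-assoc (D x) _ _))

  -- the remaining input τ of the scan starts at index i of σ
  Suffix : ℕ → List (Sym k) → Set
  Suffix i τ = i + length τ ≡ n × (∀ x → isOpenAt σ (i + x) ≡ isOpenAt τ x)

  private
    Suffix-tail : ∀ {i c τ} → Suffix i (c ∷ τ) → Suffix (suc i) τ
    Suffix-tail {i} {c} {τ} (len , opens) =
      trans (sym (+-suc i (length τ))) len ,
      λ x → trans (cong (isOpenAt σ) (sym (+-suc i x))) (opens (suc x))

    Suffix-head : ∀ {i τ} → Suffix i τ → isOpenAt σ i ≡ isOpenAt τ 0
    Suffix-head {i} (_ , opens) = trans (cong (isOpenAt σ) (sym (+-identityʳ i))) (opens 0)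

  scan-legal : ∀ {D i s} (τ : List (Sym k)) c m → Suffix i τ → ScanInv D i s →
    Legal D (scan i τ s c m) × (∀ {x} → x < n → (D ⊕⋆ scan i τ s c m) x ≡ true)
  scan-legal {D} {i} {s} [] c m (i+0≡n , _) inv =
    flush-legal (stack inv) (≤-reflexive i≡n) (stacked-fresh inv) , covered
    where
    i≡n : i ≡ n
    i≡n = trans (sym (+-identityʳ i)) i+0≡n
    covered : ∀ {x} → x < n → (D x ∨ inEvs (flush s) x) ≡ true
    covered {x} x<n with x ∈? map proj₁ s
    ... | yes x∈s = trans (cong (D x ∨_) (flush-covers s x∈s)) (∨-zeroʳ (D x))
    ... | no x∉s  = cong (_∨ inEvs (flush s) x)
                         (scanned-touched inv (<-≤-trans x<n (≤-reflexive (sym i≡n))) x∉s)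
  scan-legal {D} {i} {s} (op y ∷ τ) c m suffix inv =
    scan-legal τ c m (Suffix-tail suffix) pushed
    where
    pushed : ScanInv D (suc i) ((i , y) ∷ s)
    pushed = record
      { stack           = push ≤-refl (Suffix-head suffix) (stack inv)
      ; stacked-fresh   = λ { (here refl) → unscanned-fresh inv ≤-refl
                            ; (there x∈s) → stacked-fresh inv x∈s }
      ; scanned-touched = λ x<1+i x∉ → scanned-touched inv
          (≤∧≢⇒< (≤-pred x<1+i) (x∉ ∘ here)) (x∉ ∘ there)
      ; unscanned-fresh = λ i<x → unscanned-fresh inv (<⇒≤ i<x)
      }
  scan-legal {D} {i} {s} (cl y ∷ τ) c m suffix inv
    with closeStep i y s c m | closeStep-legal y c m inv (Suffix-head suffix) i<n
    where
    i<n : i < n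
    i<n = <-≤-trans (m<m+n i z<s) (≤-reflexive (proj₁ suffix))
  ... | es , s′ , m′ | oks , inv′ =
    let oks′ , covered = scan-legal τ c m′ (Suffix-tail suffix) inv′ in
    Legal-++ oks oks′ , λ x<n → trans (⊕⋆-++ D es _ _) (covered x<n)

  run-legal : ∀ c → Legal (λ _ → false) (run σ c) × (∀ {x} → x < n → inEvs (run σ c) x ≡ true)
  run-legal c = scan-legal σ c 0 (refl , λ _ → refl) record
    { stack = [] ; stacked-fresh = λ () ; scanned-touched = λ () ; unscanned-fresh = λ _ → refl }

touches-matchE : ∀ j i x → touches (matchE j i) x ≡ true → x ≡ j ⊎ x ≡ i
touches-matchE j i x h = Sum.map ==⇒≡ ==⇒≡ (∨-true-split (x == j) h)

touches-left : ∀ x p → touches (matchE x p) x ≡ true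
touches-left x p rewrite ==-refl x = refl

touches-right : ∀ x p → touches (matchE p x) x ≡ true
touches-right x p rewrite ==-refl x = ∨-zeroʳ (x == p)

inEvs-∈ : ∀ es {x} → inEvs es x ≡ true → ∃[ e ] (e ∈ es × touches e x ≡ true)
inEvs-∈ (e ∷ es) {x} h with ∨-true-split (touches e x) h
... | inj₁ t = e , here refl , t
... | inj₂ h′ = let e′ , e′∈es , t = inEvs-∈ es h′ in e′ , there e′∈es , t

deletedIn-∈ : ∀ es {x} → deletedIn es x ≡ true → delE x ∈ es
deletedIn-∈ (matchE _ _ ∷ es) h = there (deletedIn-∈ es h)
deletedIn-∈ (delE i ∷ es) {x} h with ∨-true-split (x == i) h
... | inj₁ x=i rewrite ==⇒≡ x=i = here refl
... | inj₂ h′ = there (deletedIn-∈ es h′)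

matchedIn-∈ : ∀ es {x y} → matchedIn es x y ≡ true → matchE x y ∈ es ⊎ matchE y x ∈ es
matchedIn-∈ (delE _ ∷ es) h = Sum.map there there (matchedIn-∈ es h)
matchedIn-∈ (matchE j i ∷ es) {x} {y} h
  with ∨-true-split (((x == j) ∧ (y == i)) ∨ ((x == i) ∧ (y == j))) h
... | inj₂ h′ = Sum.map there there (matchedIn-∈ es h′)
... | inj₁ h′ with ∨-true-split ((x == j) ∧ (y == i)) h′
...   | inj₁ xy with ∧-true-split (x == j) xy
...     | x=j , y=i rewrite ==⇒≡ x=j | ==⇒≡ y=i = inj₁ (here refl)
matchedIn-∈ (matchE j i ∷ es) {x} {y} h | inj₁ h′ | inj₂ yx with ∧-true-split (x == i) yx
...     | x=i , y=j rewrite ==⇒≡ x=i | ==⇒≡ y=j = inj₂ (here refl)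

∈-matchedIn : ∀ {es x y} → matchE x y ∈ es ⊎ matchE y x ∈ es → matchedIn es x y ≡ true
∈-matchedIn {matchE _ _ ∷ es} {x} {y} (inj₁ (here refl)) rewrite ==-refl x | ==-refl y = refl
∈-matchedIn {matchE _ _ ∷ es} {x} {y} (inj₂ (here refl)) rewrite ==-refl x | ==-refl y =
  ∨-true-l _ (∨-zeroʳ ((x == y) ∧ (y == x)))
∈-matchedIn {delE _ ∷ es} (inj₁ (there m)) = ∈-matchedIn {es} (inj₁ m)
∈-matchedIn {delE _ ∷ es} (inj₂ (there m)) = ∈-matchedIn {es} (inj₂ m)
∈-matchedIn {matchE _ _ ∷ es} (inj₁ (there m)) = ∨-true-r _ (∈-matchedIn {es} (inj₁ m))
∈-matchedIn {matchE _ _ ∷ es} (inj₂ (there m)) = ∨-true-r _ (∈-matchedIn {es} (inj₂ m))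

module LegalRuns {k : ℕ} (σ : List (Sym k)) where
  open Legality σ

  LegalEvent-fresh : ∀ {D e x} → LegalEvent D e → touches e x ≡ true → D x ≡ false
  LegalEvent-fresh (legal-del _ fx) t rewrite ==⇒≡ t = fx
  LegalEvent-fresh {x = x} (legal-match {j} {i} _ _ fj fi _ _ _) t with touches-matchE j i x t
  ... | inj₁ refl = fj
  ... | inj₂ refl = fi

  legal-fresh : ∀ {D es e x} → Legal D es → e ∈ es → touches e x ≡ true → D x ≡ false
  legal-fresh (ok ∷ _)   (here refl) t = LegalEvent-fresh ok t
  legal-fresh (_ ∷ oks) (there e∈es) t = ∨-false-l (legal-fresh oks e∈es t)

  legal-unique : ∀ {D es e₁ e₂ x} → Legal D es → e₁ ∈ es → e₂ ∈ es →
                 touches e₁ x ≡ true → touches e₂ x ≡ true → e₁ ≡ e₂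
  legal-unique _         (here refl) (here refl) _  _  = refl
  legal-unique (_ ∷ oks) (here refl) (there m₂)  t₁ t₂
    with () ← trans (sym (∨-true-r _ t₁)) (legal-fresh oks m₂ t₂)
  legal-unique (_ ∷ oks) (there m₁)  (here refl) t₁ t₂
    with () ← trans (sym (∨-true-r _ t₂)) (legal-fresh oks m₁ t₁)
  legal-unique (_ ∷ oks) (there m₁)  (there m₂)  t₁ t₂ = legal-unique oks m₁ m₂ t₁ t₂

  legal-match-∈ : ∀ {D es j i} → Legal D es → matchE j i ∈ es →
                  j < i × i < n × isOpenAt σ j ≡ true × isOpenAt σ i ≡ false
  legal-match-∈ (legal-match j<i i<n _ _ oj ci _ ∷ _) (here refl) = j<i , i<n , oj , ci
  legal-match-∈ (_ ∷ oks) (there m) = legal-match-∈ oks m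

  legal-split : ∀ {D} xs {e ys} → Legal D (xs ++ e ∷ ys) → LegalEvent (D ⊕⋆ xs) e
  legal-split {D} []       (ok ∷ _)   = LegalEvent-resp (λ x → sym (∨-identityʳ (D x))) ok
  legal-split {D} (x ∷ xs) (_ ∷ oks) =
    LegalEvent-resp (λ z → ∨-assoc (D z) (touches x z) (inEvs xs z)) (legal-split xs oks)

  -- the later of two crossing matches would have to reuse an index covered by the earlier one
  legal-non-crossing : ∀ {D es z i j y} → Legal D es → matchE z i ∈ es → matchE j y ∈ es →
                       z < j → j < i → i < y → ⊥
  legal-non-crossing _ (here refl) (here refl) z<j _ _ = <-irrefl refl z<j
  legal-non-crossing {j = j} {y} (legal-match _ _ _ _ _ _ between ∷ oks) (here refl) (there m)
                     z<j j<i _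
    with () ← trans (sym (∨-true-l _ (between z<j j<i))) (legal-fresh oks m (touches-left j y))
  legal-non-crossing {z = z} {i} (legal-match _ _ _ _ _ _ between ∷ oks) (there m) (here refl)
                     _ j<i i<y
    with () ← trans (sym (∨-true-l _ (between j<i i<y))) (legal-fresh oks m (touches-right i z))
  legal-non-crossing (_ ∷ oks) (there m₁) (there m₂) = legal-non-crossing oks m₁ m₂

  ∈-deletedIn : ∀ {es x} → delE x ∈ es → deletedIn es x ≡ true
  ∈-deletedIn {x = x} (here refl) rewrite ==-refl x = refl
  ∈-deletedIn {delE _ ∷ _}     (there m) = ∨-true-r _ (∈-deletedIn m)
  ∈-deletedIn {matchE _ _ ∷ _} (there m) = ∈-deletedIn m

  module _ {D : ℕ → Bool} {es : List Event} (legal : Legal D es) where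

    partner-of-open : ∀ {j y} → matchedIn es j y ≡ true → isOpenAt σ j ≡ true → j < y
    partner-of-open h oj with matchedIn-∈ es h
    ... | inj₁ m = proj₁ (legal-match-∈ legal m)
    ... | inj₂ m with _ , _ , _ , cj ← legal-match-∈ legal m with () ← trans (sym oj) cj

    partner-of-close : ∀ {i z} → matchedIn es i z ≡ true → isOpenAt σ i ≡ false → z < i
    partner-of-close h ci with matchedIn-∈ es h
    ... | inj₂ m = proj₁ (legal-match-∈ legal m)
    ... | inj₁ m with _ , _ , oi , _ ← legal-match-∈ legal m with () ← trans (sym oi) ci

    matched-non-crossing : ∀ {z i j y} → matchedIn es z i ≡ true → matchedIn es j y ≡ true →
                           z < j → j < i → i < y → ⊥
    matched-non-crossing h₁ h₂ z<j j<i i<y with matchedIn-∈ es h₁ | matchedIn-∈ es h₂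
    ... | inj₁ m₁ | inj₁ m₂ = legal-non-crossing legal m₁ m₂ z<j j<i i<y
    ... | inj₂ m₁ | _       = <-asym (<-trans z<j j<i) (proj₁ (legal-match-∈ legal m₁))
    ... | inj₁ _  | inj₂ m₂ = <-asym (<-trans j<i i<y) (proj₁ (legal-match-∈ legal m₂))

    legal-pairing : (∀ {x} → x < n → inEvs es x ≡ true) → Pairing n (matchedIn es) (deletedIn es)
    legal-pairing covers = record
      { partner-unique     = unique
      ; partner-sym        = ∈-matchedIn ∘ Sum.swap ∘ matchedIn-∈ es
      ; partner-≢          = irreflexive
      ; partner-<          = bounded
      ; deleted-unmatched  = deleted-unmatched
      ; deleted-or-matched = deleted-or-matched
      }
      where
      unique : ∀ {x p q} → matchedIn es x p ≡ true → matchedIn es x q ≡ true → p ≡ q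
      unique {x} {p} {q} h₁ h₂ with matchedIn-∈ es h₁ | matchedIn-∈ es h₂
      ... | inj₁ m₁ | inj₁ m₂
        with refl ← legal-unique {x = x} legal m₁ m₂ (touches-left x p) (touches-left x q) = refl
      ... | inj₁ m₁ | inj₂ m₂
        with refl ← legal-unique {x = x} legal m₁ m₂ (touches-left x p) (touches-right x q) = refl
      ... | inj₂ m₁ | inj₁ m₂
        with refl ← legal-unique {x = x} legal m₁ m₂ (touches-right x p) (touches-left x q) = refl
      ... | inj₂ m₁ | inj₂ m₂
        with refl ← legal-unique {x = x} legal m₁ m₂ (touches-right x p) (touches-right x q) = refl

      irreflexive : ∀ {x p} → matchedIn es x p ≡ true → x ≢ p
      irreflexive h with matchedIn-∈ es h
      ... | inj₁ m = <⇒≢ (proj₁ (legal-match-∈ legal m))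
      ... | inj₂ m = >⇒≢ (proj₁ (legal-match-∈ legal m))

      bounded : ∀ {x p} → matchedIn es x p ≡ true → p < n
      bounded h with matchedIn-∈ es h
      ... | inj₁ m = proj₁ (proj₂ (legal-match-∈ legal m))
      ... | inj₂ m = let p<x , x<n , _ = legal-match-∈ legal m in <-trans p<x x<n

      deleted-unmatched : ∀ {x p} → deletedIn es x ≡ true → matchedIn es x p ≡ true → ⊥
      deleted-unmatched {x} {p} hd hm with matchedIn-∈ es hm
      ... | inj₁ m
        with () ← legal-unique {x = x} legal (deletedIn-∈ es hd) m (==-refl x) (touches-left x p)
      ... | inj₂ m
        with () ← legal-unique {x = x} legal (deletedIn-∈ es hd) m (==-refl x) (touches-right x p)

      deleted-or-matched : ∀ {x} → x < n → deletedIn es x ≡ true ⊎ ∃[ p ] matchedIn es x p ≡ true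
      deleted-or-matched {x} x<n with inEvs-∈ es (covers x<n)
      ... | delE y , m , t rewrite ==⇒≡ t = inj₁ (∈-deletedIn m)
      ... | matchE j i , m , t with touches-matchE j i x t
      ...   | inj₁ refl = inj₂ (i , ∈-matchedIn (inj₁ m))
      ...   | inj₂ refl = inj₂ (j , ∈-matchedIn (inj₂ m))

event-at : {A : Set} (es : List A) {t : ℕ} → t < length es →
  ∃[ e ] (es ≡ take t es ++ e ∷ drop (suc t) es × take (suc t) es ≡ take t es ++ [ e ]
          × take 1 (drop t es) ≡ [ e ])
event-at (e ∷ es) {zero}  _  = e , refl , refl , refl
event-at (e ∷ es) {suc t} lt =
  let e′ , split , prefix , at = event-at es (≤-pred lt) in
  e′ , cong (e ∷_) split , cong (e ∷_) prefix , at

module RunAnalysis {k : ℕ} (σ : List (Sym k)) (coins copt : Coins) where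
  open Legality σ
  open LegalRuns σ

  R O : List Event
  R = run σ coins
  O = run σ copt

  legal-O : Legal (λ _ → false) O
  legal-O = proj₁ (run-legal copt)

  open Potential (legal-pairing legal-O (proj₂ (run-legal copt)))
  open Pairing (legal-pairing legal-O (proj₂ (run-legal copt)))

  no-pending-pair : ∀ {a : ℕ → Bool} {j i y z : ℕ} →
    j < i → isOpenAt σ j ≡ true → isOpenAt σ i ≡ false →
    (∀ {x} → j < x → x < i → a x ≡ true) →
    matchedIn O j y ≡ true → a y ≡ false → matchedIn O i z ≡ true → (a z ∨ (z == j)) ≡ false → ⊥
  no-pending-pair {a} {j} {i} {y} {z} j<i oj ci between my y∉a mz z∉a₁ =
    matched-non-crossing legal-O (partner-sym mz) my z<j j<i i<y
    where
    z≢j : z ≢ j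
    z≢j refl = true≢false (trans (sym (∨-true-r (a z) (==-refl z))) z∉a₁)
    y≢i : y ≢ i
    y≢i refl = z≢j (sym (partner-unique (partner-sym my) mz))
    i<y : i < y
    i<y = ≤∧≢⇒< (≮⇒≥ λ y<i →
            true≢false (trans (sym (between (partner-of-open legal-O my oj) y<i)) y∉a)) (y≢i ∘ sym)
    z<j : z < j
    z<j = ≤∧≢⇒< (≮⇒≥ λ j<z → true≢false
            (trans (sym (between j<z (partner-of-close legal-O mz ci))) (∨-false-l z∉a₁))) z≢j

  event-drift : ∀ {a a′ : ℕ → Bool} {e} → LegalEvent a e → (∀ i → a′ i ≡ (a ⊕ e) i) →
    Drift (gap a) (dels a) (gap a′) (dels a′)
          (toℕ (isDel e ∧ ⌊ gap a′ ≤? gap a ⌋)) (toℕ (isDel e ∧ not ⌊ gap a′ ≤? gap a ⌋))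
  event-drift {a} {a′} (legal-del x<n x∉a) a′≗ with touch a′≗ x∉a x<n
  ... | settled d = drift-weaken (one-move ⌊ gap a′ ≤? gap a ⌋) d
    where
    one-move : ∀ b → toℕ b + 0 ≤ 1 + toℕ (not b)
    one-move true  = ≤-refl
    one-move false = z≤n
  ... | pending _ _ d gap-grows with gap a′ ≤? gap a
  ...   | yes gap′≤gap = ⊥-elim (<⇒≱ gap-grows gap′≤gap)
  ...   | no  _        = d
  event-drift {a} {a′} (legal-match {j} {i} j<i i<n j∉a i∉a oj ci between) a′≗
    with touch {a} {a₁} (λ _ → refl) j∉a (<-trans j<i i<n) | touch {a₁} {a′} a′≗₁ i∉a₁ i<n
    where
    a₁ : ℕ → Bool
    a₁ z = a z ∨ (z == j)
    a′≗₁ : ∀ z → a′ z ≡ a₁ z ∨ (z == i)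
    a′≗₁ z = trans (a′≗ z) (sym (∨-assoc (a z) (z == j) (z == i)))
    i∉a₁ : a₁ i ≡ false
    i∉a₁ = ∨-false i∉a (≢⇒==-false (>⇒≢ j<i))
  ... | settled d₁        | settled d₂        = drift-weaken z≤n (drift-trans d₁ d₂)
  ... | settled d₁        | pending _ _ d₂ _  = drift-weaken ≤-refl (drift-trans d₁ d₂)
  ... | pending _ _ d₁ _  | settled d₂        = drift-weaken ≤-refl (drift-trans d₁ d₂)
  ... | pending my y∉a _ _ | pending mz z∉a₁ _ _ =
    ⊥-elim (no-pending-pair j<i oj ci between my y∉a mz z∉a₁)

  module Q = Quantities σ R O

  step : ∀ t → t < length R →
    Drift (Q.gap t) (Q.d t) (Q.gap (suc t)) (Q.d (suc t))
          (toℕ (Q.correctAt (suc t))) (toℕ (Q.wrongAt (suc t)))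
  step t t<len with event-at R t<len
  ... | e , split , prefix , at =
    subst₂ (Drift (Q.gap t) (Q.d t) (Q.gap (suc t)) (Q.d (suc t)))
      (cong (λ b → toℕ (b ∧ _)) (sym is-del)) (cong (λ b → toℕ (b ∧ _)) (sym is-del))
      (event-drift (legal-split (take t R) (subst (Legal _) split (proj₁ (run-legal coins))))
                   next)
    where
    is-del : Q.delAt (suc t) ≡ isDel e
    is-del = trans (cong (any isDel) at) (∨-identityʳ (isDel e))
    next : ∀ i → Q.A (suc t) i ≡ Q.A t i ∨ touches e i
    next i = trans (cong (λ es → inEvs es i) prefix)
               (trans (any-++ (λ e′ → touches e′ i) (take t R) [ e ])
                      (cong (Q.A t i ∨_) (∨-identityʳ (touches e i))))

  invariant : ∀ t → t ≤ length R → Drift 0 0 (Q.gap t) (Q.d t) (Q.c t) (Q.w t)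
  invariant zero    _  = drift (≤-trans (≤-reflexive (cong (λ g → g + 0 + 0) gap-∅)) z≤n)
  invariant (suc t) lt =
    subst₂ (Drift 0 0 (Q.gap (suc t)) (Q.d (suc t)))
      (sym (count-upTo-suc Q.correctAt (suc t))) (sym (count-upTo-suc Q.wrongAt (suc t)))
      (drift-trans (invariant t (<⇒≤ lt)) (step t lt))

lemma4 : (k : ℕ) (σ : List (Sym k)) (coins copt : Coins) →
    Optimal σ copt →
    (t : ℕ) → t ≤ length (run σ coins) →
    Quantities.gap σ (run σ coins) (run σ copt) t
      + Quantities.c σ (run σ coins) (run σ copt) t
    ≤ Quantities.d σ (run σ coins) (run σ copt) t
      + Quantities.w σ (run σ coins) (run σ copt) t
lemma4 k σ coins copt _ t t≤len =
  subst (_≤ Q.d t + Q.w t) (cong (_+ Q.c t) (+-identityʳ (Q.gap t))) (bound (invariant t t≤len))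
  where open RunAnalysis σ coins copt
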